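{- For partitions $\lambda$ and $\mu$, $$e_\lambda[\Xi_\mu]=\sum_{S^{(*)}\in\overline{\mathbf C}_{\lambda,\mu}}(-1)^{|\lambda|+|S^{(*)}|},$$ where $|S^{(*)}|=\sum_{i=1}^{\ell(\lambda)}|S^{(i)}|$.
   Context: $e_\lambda=\prod_je_{\lambda_j}$ is the elementary symmetric function. For a partition $\nu$, $\Xi_\nu$ is the multiset of complex numbers consisting, for each part $\nu_j$, of all $\nu_j$-th roots of unity, and $f[\Xi_\nu]$ denotes the symmetric function $f$ evaluated at these $|\nu|$ values (equivalently, each power sum $p_k$ replaced by the sum of $k$-th powers of the elements of $\Xi_\nu$). For $S\subseteq\{1,\ldots,\ell(\mu)\}$, $\mu_S$ is the subpartition $(\mu_i)_{i\in S}$ and $|\mu_S|=\sum_{i\in S}\mu_i$. $\overline{\mathbf C}_{\lambda,\mu}$ is the set of sequences $(S^{(1)},\ldots,S^{(\ell(\lambda))})$ of subsets of $\{1,\ldots,\ell(\mu)\}$ with $|\mu_{S^{(i)}}|=\lambda_i$ for each $i$. -}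

module Defs where

open import Level using (Level)
open import Data.Bool using (Bool; true; false; if_then_else_)
open import Data.Nat as ℕ using (ℕ; zero; suc; _≥_; _<_)
open import Data.Nat.Properties using (_≟_)
open import Data.Nat.ListAction using (sum)
open import Data.Vec.Properties using (≡-dec)
open import Data.List as List using (List; []; _∷_; map; concatMap; upTo; length; filter; foldr; cartesianProductWith)
open import Data.List.Relation.Unary.All using (All)
open import Data.List.Relation.Unary.Linked using (Linked)
open import Data.Vec as Vec using (Vec; []; _∷_; lookup; toList)
open import Data.Fin using (Fin)
open import Data.Fin.Subset using (Subset; inside; ∣_∣)
open import Relation.Nullary using (¬_)
open import Relation.Binary.PropositionalEquality using (_≡_)
open import Algebra.Bundles using (CommutativeRing)

IsPartition : List ℕ → Set
IsPartition λs = All (λ p → p ≥ 1) λs × Linked (λ a b → a ≥ b) λs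
  where open import Data.Product using (_×_)

module _ {c ℓ : Level} (R : CommutativeRing c ℓ) where
  open CommutativeRing R

  pow : Carrier → ℕ → Carrier
  pow x zero    = 1#
  pow x (suc n) = x * pow x n

  IsIntegralDomain : Set (c Level.⊔ ℓ)
  IsIntegralDomain = (¬ (1# ≈ 0#)) × (∀ x y → x * y ≈ 0# → (x ≈ 0#) ⊎ (y ≈ 0#))
    where open import Data.Product using (_×_)
          open import Data.Sum using (_⊎_)

  IsPrimitiveRoot : ℕ → Carrier → Set ℓ
  IsPrimitiveRoot m ω = (pow ω m ≈ 1#) × (∀ k → 1 ℕ.≤ k → k < m → ¬ (pow ω k ≈ 1#))
    where open import Data.Product using (_×_)

  e : ℕ → List Carrier → Carrier
  e zero    xs       = 1#
  e (suc n) []       = 0#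
  e (suc n) (x ∷ xs) = x * e n xs + e (suc n) xs

  eP : List ℕ → List Carrier → Carrier
  eP λs xs = foldr (λ n acc → e n xs * acc) 1# λs

  -- Ξ_ν : for each part ν_j, all ν_j-th roots of unity ω_{ν_j}^k, 0 ≤ k < ν_j,
  -- where ω m is a primitive m-th root of unity.
  Ξ : (ℕ → Carrier) → List ℕ → List Carrier
  Ξ ω ν = concatMap (λ m → map (pow (ω m)) (upTo m)) ν

  sumR : List Carrier → Carrier
  sumR = foldr _+_ 0#

  sign : ℕ → Carrier
  sign k = pow (- 1#) k

allSubsets : (n : ℕ) → List (Subset n)
allSubsets zero    = [] ∷ []
allSubsets (suc n) = map (true ∷_) (allSubsets n) List.++ map (false ∷_) (allSubsets n)

allSeqs : (n k : ℕ) → List (Vec (Subset n) k)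
allSeqs n zero    = [] ∷ []
allSeqs n (suc k) = cartesianProductWith _∷_ (allSubsets n) (allSeqs n k)

weight : (μ : List ℕ) → Subset (length μ) → ℕ
weight μ S = sum (toList (Vec.zipWith (λ b m → if b then m else 0) S (Vec.fromList μ)))

weights : (μ : List ℕ) → ∀ {k} → Vec (Subset (length μ)) k → Vec ℕ k
weights μ Ss = Vec.map (weight μ) Ss

Cbar : (λs μ : List ℕ) → List (Vec (Subset (length μ)) (length λs))
Cbar λs μ = filter (λ Ss → ≡-dec _≟_ (weights μ Ss) (Vec.fromList λs)) (allSeqs (length μ) (length λs))

totalCard : ∀ {n k} → Vec (Subset n) k → ℕ
totalCard Ss = sum (toList (Vec.map ∣_∣ Ss))

module Submission where

-- Put g_μ(n) = Σ_{S ⊆ parts of μ, |μ_S| = n} (-1)^{n+|S|}.  The proof has two halves.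
--
-- (1) e_n[Ξ_μ] = g_μ(n) for all n.  For a primitive m-th root w, the list of roots
--     X = (1, w, …, w^{m-1}) has e_a(X) = 1, 0, (-1)^{m+1}, 0 for a = 0, 0 < a < m,
--     a = m, a > m: multiplying by w permutes X, so w^a e_a(X) = e_a(X), and in an
--     integral domain this kills e_a(X) for 0 < a < m; writing X = 1 ∷ Y, the relation
--     e_a(X) = e_{a-1}(Y) + e_a(Y) then forces e_a(Y) = (-1)^a and e_m(X) = (-1)^{m-1}.
--     As e_n of a concatenation is the convolution Σ_{a+b=n} e_a e_b, adjoining the roots
--     of a part m multiplies the generating function by 1 + (-1)^{m+1} t^m, which is the
--     recursion of g_μ obtained by deciding whether the new part lies in S.
-- (2) The signed sum over sequences (S⁽¹⁾,…,S⁽ᵏ⁾) factorises over the coordinates,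
--     so it equals ∏_i g_μ(λ_i) = ∏_i e_{λ_i}[Ξ_μ] = e_λ[Ξ_μ].

open import Defs
open import Level using (Level)
open import Data.Nat as ℕ using (ℕ; zero; suc; _∸_; _≤_; _<_; _≥_; s≤s; z≤n)
import Data.Nat.Properties as ℕP
open import Data.Nat.ListAction using (sum)
open import Data.Bool using (Bool; true; false; if_then_else_; _∧_)
open import Data.Product using (_,_; proj₁; proj₂)
open import Data.Sum using (inj₁; inj₂)
open import Data.Empty using (⊥-elim)
open import Data.List using (List; []; _∷_; _++_; _∷ʳ_; map; length; filter; applyUpTo; cartesianProductWith)
import Data.List.Properties as LP
open import Data.List.Relation.Binary.Permutation.Propositional as ↭ using (_↭_; ↭-sym)
open import Data.List.Relation.Binary.Permutation.Propositional.Properties using (∷↭∷ʳ)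
open import Data.List.Relation.Unary.All using (All; []; _∷_)
open import Data.Vec as V using (Vec)
open import Data.Vec.Properties using (≡-dec)
open import Data.Fin.Subset using (Subset; ∣_∣)
open import Relation.Nullary using (Dec; yes; no; does; ¬_)
open import Relation.Unary using (Decidable)
open import Relation.Binary.PropositionalEquality as P using (_≡_)
open import Relation.Binary.Definitions using (tri<; tri≈; tri>)
open import Algebra.Bundles using (CommutativeRing)
open import Algebra.Properties.CommutativeSemigroup ℕP.+-commutativeSemigroup
  using () renaming (interchange to ℕ-interchange)

module _ {c ℓ : Level} (R : CommutativeRing c ℓ) where
  open CommutativeRing R
  open import Algebra.Properties.Ring ring
    using (-1*x≈-x; -‿involutive; x∙y⁻¹≈ε⇒x≈y; +-inverseʳ-unique; [y-z]x≈yx-zx)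
  open import Algebra.Properties.CommutativeSemigroup +-commutativeSemigroup
    using (x∙yz≈y∙xz) renaming (interchange to +-interchange)
  open import Algebra.Solver.Ring.NaturalCoefficients.Default commutativeSemiring
    using (solve; _:=_; _:+_; _:*_)
  open import Relation.Binary.Reasoning.Setoid setoid

  ∑ : List Carrier → Carrier
  ∑ = sumR R

  E : ℕ → List Carrier → Carrier
  E = e R

  pw : Carrier → ℕ → Carrier
  pw = pow R

  sgn : ℕ → Carrier
  sgn = sign R

  ∑-++ : ∀ xs ys → ∑ (xs ++ ys) ≈ ∑ xs + ∑ ys
  ∑-++ []       ys = sym (+-identityˡ _)
  ∑-++ (x ∷ xs) ys = trans (+-congˡ (∑-++ xs ys)) (sym (+-assoc _ _ _))

  ∑-cong : ∀ {a} {A : Set a} {f g : A → Carrier} xs →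
           (∀ x → f x ≈ g x) → ∑ (map f xs) ≈ ∑ (map g xs)
  ∑-cong []       f≈g = refl
  ∑-cong (x ∷ xs) f≈g = +-cong (f≈g x) (∑-cong xs f≈g)

  ∑-zero : ∀ {a} {A : Set a} {f : A → Carrier} xs → (∀ x → f x ≈ 0#) → ∑ (map f xs) ≈ 0#
  ∑-zero []       f≈0 = refl
  ∑-zero (x ∷ xs) f≈0 = trans (+-cong (f≈0 x) (∑-zero xs f≈0)) (+-identityˡ _)

  ∑-*ˡ : ∀ {a} {A : Set a} (b : Carrier) (f : A → Carrier) xs →
         b * ∑ (map f xs) ≈ ∑ (map (λ x → b * f x) xs)
  ∑-*ˡ b f []       = zeroʳ b
  ∑-*ˡ b f (x ∷ xs) = trans (distribˡ b _ _) (+-congˡ (∑-*ˡ b f xs))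

  ∑-*ʳ : ∀ {a} {A : Set a} (b : Carrier) (f : A → Carrier) xs →
         ∑ (map f xs) * b ≈ ∑ (map (λ x → f x * b) xs)
  ∑-*ʳ b f []       = zeroˡ b
  ∑-*ʳ b f (x ∷ xs) = trans (distribʳ b _ _) (+-congˡ (∑-*ʳ b f xs))

  ∑-filter : ∀ {a p} {A : Set a} {Q : A → Set p} (Q? : Decidable Q) (f : A → Carrier) xs →
             ∑ (map f (filter Q? xs)) ≈ ∑ (map (λ x → if does (Q? x) then f x else 0#) xs)
  ∑-filter Q? f [] = refl
  ∑-filter Q? f (x ∷ xs) with does (Q? x)
  ... | true  = +-congˡ (∑-filter Q? f xs)
  ... | false = trans (∑-filter Q? f xs) (sym (+-identityˡ _))

  ∑-cartesian : ∀ {a} {A : Set a} {k} (h : Vec A (suc k) → Carrier) (As : List A) (Bs : List (Vec A k)) →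
                ∑ (map h (cartesianProductWith V._∷_ As Bs)) ≈
                ∑ (map (λ S → ∑ (map (λ Ss → h (S V.∷ Ss)) Bs)) As)
  ∑-cartesian h []       Bs = refl
  ∑-cartesian h (S ∷ As) Bs = begin
    ∑ (map h (map (S V.∷_) Bs ++ cartesianProductWith V._∷_ As Bs))
      ≡⟨ P.cong ∑ (LP.map-++ h (map (S V.∷_) Bs) _) ⟩
    ∑ (map h (map (S V.∷_) Bs) ++ map h (cartesianProductWith V._∷_ As Bs))
      ≈⟨ ∑-++ (map h (map (S V.∷_) Bs)) _ ⟩
    ∑ (map h (map (S V.∷_) Bs)) + ∑ (map h (cartesianProductWith V._∷_ As Bs))
      ≈⟨ +-cong (reflexive (P.cong ∑ (P.sym (LP.map-∘ Bs)))) (∑-cartesian h As Bs) ⟩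
    ∑ (map (λ Ss → h (S V.∷ Ss)) Bs) + ∑ (map (λ S → ∑ (map (λ Ss → h (S V.∷ Ss)) Bs)) As) ∎

  pw-+ : ∀ x m n → pw x (m ℕ.+ n) ≈ pw x m * pw x n
  pw-+ x zero    n = sym (*-identityˡ _)
  pw-+ x (suc m) n = trans (*-congˡ (pw-+ x m n)) (sym (*-assoc _ _ _))

  sgn-suc : ∀ n → sgn (suc n) ≈ - sgn n
  sgn-suc n = -1*x≈-x (sgn n)

  sgn-suc-suc : ∀ n → sgn (suc (suc n)) ≈ sgn n
  sgn-suc-suc n = trans (sgn-suc (suc n)) (trans (-‿cong (sgn-suc n)) (-‿involutive (sgn n)))

  e-vanish : ∀ n xs → length xs ≤ n → E (suc n) xs ≈ 0#
  e-vanish n       []       _          = refl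
  e-vanish (suc n) (x ∷ xs) (s≤s |xs|≤n) = begin
    x * E (suc n) xs + E (suc (suc n)) xs
      ≈⟨ +-cong (*-congˡ (e-vanish n xs |xs|≤n)) (e-vanish (suc n) xs (ℕP.m≤n⇒m≤1+n |xs|≤n)) ⟩
    x * 0# + 0# ≈⟨ trans (+-identityʳ _) (zeroʳ x) ⟩
    0# ∎

  e-head-cong : ∀ {x y} → x ≈ y → ∀ n xs → E n (x ∷ xs) ≈ E n (y ∷ xs)
  e-head-cong x≈y zero    xs = refl
  e-head-cong x≈y (suc n) xs = +-congʳ (*-congʳ x≈y)

  e-prep : ∀ x {xs ys} → (∀ n → E n xs ≈ E n ys) → ∀ n → E n (x ∷ xs) ≈ E n (x ∷ ys)
  e-prep x eq zero    = refl
  e-prep x eq (suc n) = +-cong (*-congˡ (eq n)) (eq (suc n))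

  e-swap : ∀ x y {xs} n → E n (x ∷ y ∷ xs) ≈ E n (y ∷ x ∷ xs)
  e-swap x y zero          = refl
  e-swap x y {xs} (suc zero) =
    solve 4 (λ x y o a → x :* o :+ (y :* o :+ a) := y :* o :+ (x :* o :+ a)) refl x y 1# (E 1 xs)
  e-swap x y {xs} (suc (suc n)) =
    solve 5 (λ x y a b c → x :* (y :* a :+ b) :+ (y :* b :+ c) := y :* (x :* a :+ b) :+ (x :* b :+ c))
      refl x y (E n xs) (E (suc n) xs) (E (suc (suc n)) xs)

  e-perm : ∀ {xs ys} → xs ↭ ys → ∀ n → E n xs ≈ E n ys
  e-perm ↭.refl                n = refl
  e-perm (↭.prep x p)           n = e-prep x (e-perm p) n
  e-perm (↭.swap x y p)         n = trans (e-swap x y n) (e-prep y (e-prep x (e-perm p)) n)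
  e-perm (↭.trans p q)          n = trans (e-perm p n) (e-perm q n)

  e-homogeneous : ∀ b n xs → E n (map (b *_) xs) ≈ pw b n * E n xs
  e-homogeneous b zero    xs       = sym (*-identityˡ 1#)
  e-homogeneous b (suc n) []       = sym (zeroʳ _)
  e-homogeneous b (suc n) (x ∷ xs) = begin
    (b * x) * E n (map (b *_) xs) + E (suc n) (map (b *_) xs)
      ≈⟨ +-cong (*-congˡ (e-homogeneous b n xs)) (e-homogeneous b (suc n) xs) ⟩
    (b * x) * (pw b n * E n xs) + (b * pw b n) * E (suc n) xs
      ≈⟨ solve 5 (λ b x p A B → (b :* x) :* (p :* A) :+ (b :* p) :* B := (b :* p) :* (x :* A :+ B))
           refl b x (pw b n) (E n xs) (E (suc n) xs) ⟩
    (b * pw b n) * (x * E n xs + E (suc n) xs) ∎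

  conv : ℕ → (ℕ → Carrier) → (ℕ → Carrier) → Carrier
  conv zero    f g = f 0 * g 0
  conv (suc n) f g = f 0 * g (suc n) + conv n (λ a → f (suc a)) g

  conv-cong : ∀ n {f f′ g g′} → (∀ a → f a ≈ f′ a) → (∀ b → g b ≈ g′ b) → conv n f g ≈ conv n f′ g′
  conv-cong zero    f≈ g≈ = *-cong (f≈ 0) (g≈ 0)
  conv-cong (suc n) f≈ g≈ = +-cong (*-cong (f≈ 0) (g≈ (suc n))) (conv-cong n (λ a → f≈ (suc a)) g≈)

  conv-+ : ∀ n f f′ g → conv n (λ a → f a + f′ a) g ≈ conv n f g + conv n f′ g
  conv-+ zero    f f′ g = distribʳ (g 0) (f 0) (f′ 0)
  conv-+ (suc n) f f′ g = begin
    (f 0 + f′ 0) * g (suc n) + conv n (λ a → f (suc a) + f′ (suc a)) g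
      ≈⟨ +-cong (distribʳ (g (suc n)) (f 0) (f′ 0)) (conv-+ n (λ a → f (suc a)) (λ a → f′ (suc a)) g) ⟩
    (f 0 * g (suc n) + f′ 0 * g (suc n)) + (conv n (λ a → f (suc a)) g + conv n (λ a → f′ (suc a)) g)
      ≈⟨ +-interchange _ _ _ _ ⟩
    (f 0 * g (suc n) + conv n (λ a → f (suc a)) g) + (f′ 0 * g (suc n) + conv n (λ a → f′ (suc a)) g) ∎

  conv-* : ∀ n b f g → conv n (λ a → b * f a) g ≈ b * conv n f g
  conv-* zero    b f g = *-assoc b (f 0) (g 0)
  conv-* (suc n) b f g = trans (+-cong (*-assoc b (f 0) (g (suc n))) (conv-* n b (λ a → f (suc a)) g))
                               (sym (distribˡ b _ _))

  conv-zero : ∀ n f g → (∀ a → f a ≈ 0#) → conv n f g ≈ 0#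
  conv-zero zero    f g f≈0 = trans (*-congʳ (f≈0 0)) (zeroˡ _)
  conv-zero (suc n) f g f≈0 =
    trans (+-cong (trans (*-congʳ (f≈0 0)) (zeroˡ _)) (conv-zero n _ g (λ a → f≈0 (suc a)))) (+-identityʳ 0#)

  spike : ℕ → Carrier → ℕ → Carrier
  spike zero    s zero    = s
  spike zero    s (suc a) = 0#
  spike (suc k) s zero    = 0#
  spike (suc k) s (suc a) = spike k s a

  spike-at : ∀ k s → spike k s k ≈ s
  spike-at zero    s = refl
  spike-at (suc k) s = spike-at k s

  spike-off : ∀ k s a → ¬ (a ≡ k) → spike k s a ≈ 0#
  spike-off zero    s zero    a≢k = ⊥-elim (a≢k P.refl)
  spike-off zero    s (suc a) a≢k = refl
  spike-off (suc k) s zero    a≢k = refl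
  spike-off (suc k) s (suc a) a≢k = spike-off k s a (λ a≡k → a≢k (P.cong suc a≡k))

  -- shift m n g = g (n ∸ m) when m ≤ n, and 0 otherwise: the coefficient of t^n in t^m G(t).
  shift : ℕ → ℕ → (ℕ → Carrier) → Carrier
  shift zero    n       g = g n
  shift (suc m) zero    g = 0#
  shift (suc m) (suc n) g = shift m n g

  shift-cong : ∀ m n {g g′} → (∀ b → g b ≈ g′ b) → shift m n g ≈ shift m n g′
  shift-cong zero    n       g≈ = g≈ n
  shift-cong (suc m) zero    g≈ = refl
  shift-cong (suc m) (suc n) g≈ = shift-cong m n g≈

  conv-spike : ∀ k n s g → conv n (spike k s) g ≈ s * shift k n g
  conv-spike zero    zero    s g = refl
  conv-spike (suc k) zero    s g = trans (zeroˡ _) (sym (zeroʳ s))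
  conv-spike zero    (suc n) s g = trans (+-congˡ (conv-zero n _ g (λ a → refl))) (+-identityʳ _)
  conv-spike (suc k) (suc n) s g = trans (+-congʳ (zeroˡ _)) (trans (+-identityˡ _) (conv-spike k n s g))

  e-++ : ∀ xs ys n → E n (xs ++ ys) ≈ conv n (λ a → E a xs) (λ b → E b ys)
  e-++ []       ys n = begin
    E n ys                             ≈⟨ sym (*-identityˡ _) ⟩
    1# * E n ys                        ≈⟨ sym (conv-spike 0 n 1# (λ b → E b ys)) ⟩
    conv n (spike 0 1#) (λ b → E b ys) ≈⟨ conv-cong n (λ { zero → refl ; (suc a) → refl }) (λ _ → refl) ⟩
    conv n (λ a → E a []) (λ b → E b ys) ∎
  e-++ (x ∷ xs) ys zero    = sym (*-identityˡ 1#)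
  e-++ (x ∷ xs) ys (suc n) = begin
    x * E n (xs ++ ys) + E (suc n) (xs ++ ys)
      ≈⟨ +-cong (*-congˡ (e-++ xs ys n)) (e-++ xs ys (suc n)) ⟩
    x * conv n f g + (1# * g (suc n) + conv n (λ a → f (suc a)) g)
      ≈⟨ x∙yz≈y∙xz _ _ _ ⟩
    1# * g (suc n) + (x * conv n f g + conv n (λ a → f (suc a)) g)
      ≈⟨ +-congˡ (sym (trans (conv-+ n (λ a → x * f a) (λ a → f (suc a)) g) (+-congʳ (conv-* n x f g)))) ⟩
    1# * g (suc n) + conv n (λ a → x * E a xs + E (suc a) xs) g ∎
    where
    f g : ℕ → Carrier
    f a = E a xs
    g b = E b ys

  -- The m-th roots of unity X = (1, w, …, w^{m-1}) for a primitive root w, m = m′ + 1.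
  module RootsOfUnity (domain : IsIntegralDomain R) (w : Carrier) (m′ : ℕ)
                      (isPrimitive : IsPrimitiveRoot R (suc m′) w) where

    m : ℕ
    m = suc m′

    -- X = 1 ∷ Y holds definitionally.
    X Y : List Carrier
    X = applyUpTo (pw w) m
    Y = applyUpTo (λ i → pw w (suc i)) m′

    -- Multiplying by w sends X to Y ∷ʳ w^m, a permutation of w^m ∷ Y, and w^m ≈ 1.
    e-invariant : ∀ a → pw w a * E a X ≈ E a X
    e-invariant a = begin
      pw w a * E a X                 ≈⟨ sym (e-homogeneous w a X) ⟩
      E a (map (w *_) X)             ≡⟨ P.cong (E a) (LP.map-applyUpTo (pw w) (w *_) m) ⟩
      E a (applyUpTo (λ i → pw w (suc i)) m) ≡⟨ P.cong (E a) (P.sym (LP.applyUpTo-∷ʳ _ m′)) ⟩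
      E a (Y ∷ʳ pw w m)              ≈⟨ e-perm (↭-sym (∷↭∷ʳ (pw w m) Y)) a ⟩
      E a (pw w m ∷ Y)               ≈⟨ e-head-cong (proj₁ isPrimitive) a Y ⟩
      E a X                          ∎

    annihilated : ∀ a → (pw w a - 1#) * E a X ≈ 0#
    annihilated a = begin
      (pw w a - 1#) * E a X       ≈⟨ [y-z]x≈yx-zx (E a X) (pw w a) 1# ⟩
      pw w a * E a X - 1# * E a X ≈⟨ +-cong (e-invariant a) (-‿cong (*-identityˡ _)) ⟩
      E a X - E a X               ≈⟨ -‿inverseʳ _ ⟩
      0#                          ∎

    -- Since w^a ≉ 1 for 0 < a < m, e_a(X) vanishes there.
    e-middle : ∀ a → 1 ≤ a → a < m → E a X ≈ 0#
    e-middle a 1≤a a<m with proj₂ domain (pw w a - 1#) (E a X) (annihilated a)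
    ... | inj₁ wᵃ-1≈0 = ⊥-elim (proj₂ isPrimitive a 1≤a a<m (x∙y⁻¹≈ε⇒x≈y _ _ wᵃ-1≈0))
    ... | inj₂ eₐ≈0   = eₐ≈0

    -- From 0 ≈ e_{a+1}(1 ∷ Y) = e_a(Y) + e_{a+1}(Y) for a + 1 < m.
    e-tail : ∀ a → a < m → E a Y ≈ sgn a
    e-tail zero    _     = refl
    e-tail (suc a) a+1<m = begin
      E (suc a) Y    ≈⟨ +-inverseʳ-unique (1# * E a Y) (E (suc a) Y) (e-middle (suc a) (s≤s z≤n) a+1<m) ⟩
      - (1# * E a Y) ≈⟨ -‿cong (trans (*-identityˡ _) (e-tail a (ℕP.<⇒≤ a+1<m))) ⟩
      - sgn a        ≈⟨ sym (sgn-suc a) ⟩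
      sgn (suc a)    ∎

    -- e_m(X) = e_{m-1}(Y) + e_m(Y) = (-1)^{m-1}, as Y has only m - 1 entries.
    e-top : E m X ≈ sgn (suc m)
    e-top = begin
      1# * E m′ Y + E m Y ≈⟨ +-cong (*-identityˡ _) (e-vanish m′ Y (ℕP.≤-reflexive (LP.length-applyUpTo _ m′))) ⟩
      E m′ Y + 0#         ≈⟨ +-identityʳ _ ⟩
      E m′ Y              ≈⟨ e-tail m′ (ℕP.n<1+n m′) ⟩
      sgn m′              ≈⟨ sym (sgn-suc-suc m′) ⟩
      sgn (suc m)         ∎

    e-roots : ∀ a → E a X ≈ spike 0 1# a + spike m (sgn (suc m)) a
    e-roots zero = sym (+-identityʳ 1#)
    e-roots (suc a) with ℕP.<-cmp a m′
    ... | tri< a<m′ a≢m′ _ = trans (e-middle (suc a) (s≤s z≤n) (s≤s a<m′))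
                                   (sym (trans (+-identityˡ _) (spike-off m′ _ a a≢m′)))
    ... | tri≈ _ P.refl _  = trans e-top (sym (trans (+-identityˡ _) (spike-at m′ _)))
    ... | tri> _ a≢m′ m′<a = trans (e-vanish a X (ℕP.≤-trans (ℕP.≤-reflexive (LP.length-applyUpTo (pw w) m)) m′<a))
                                   (sym (trans (+-identityˡ _) (spike-off m′ _ a a≢m′)))

    e-roots-++ : ∀ n ys → E n (X ++ ys) ≈ E n ys + sgn (suc m) * shift m n (λ b → E b ys)
    e-roots-++ n ys = begin
      E n (X ++ ys)                                    ≈⟨ e-++ X ys n ⟩
      conv n (λ a → E a X) g                           ≈⟨ conv-cong n e-roots (λ _ → refl) ⟩
      conv n (λ a → spike 0 1# a + spike m s a) g      ≈⟨ conv-+ n _ _ g ⟩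
      conv n (spike 0 1#) g + conv n (spike m s) g     ≈⟨ +-cong (conv-spike 0 n 1# g) (conv-spike m n s g) ⟩
      1# * E n ys + s * shift m n g                    ≈⟨ +-congʳ (*-identityˡ _) ⟩
      E n ys + s * shift m n g                         ∎
      where
      s : Carrier
      s = sgn (suc m)
      g : ℕ → Carrier
      g b = E b ys

  -- Part (1).  The contribution of S to g_μ(n), and g_μ(n) itself.
  φ : (μ : List ℕ) → ℕ → Subset (length μ) → Carrier
  φ μ n S = if does (weight μ S ℕP.≟ n) then sgn (n ℕ.+ ∣ S ∣) else 0#

  subsetSum : List ℕ → ℕ → Carrier
  subsetSum μ n = ∑ (map (φ μ n) (allSubsets (length μ)))

  shift-∑ : ∀ {a} {B : Set a} m n (ψ : ℕ → B → Carrier) xs →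
            shift m n (λ k → ∑ (map (ψ k) xs)) ≈ ∑ (map (λ x → shift m n (λ k → ψ k x)) xs)
  shift-∑ zero    n       ψ xs = refl
  shift-∑ (suc m) zero    ψ xs = sym (∑-zero xs (λ _ → refl))
  shift-∑ (suc m) (suc n) ψ xs = shift-∑ m n ψ xs

  shift-indicator : ∀ m n w (v : ℕ → Carrier) →
                    shift m n (λ k → if does (w ℕP.≟ k) then v k else 0#) ≈
                    (if does ((m ℕ.+ w) ℕP.≟ n) then v (n ∸ m) else 0#)
  shift-indicator zero    n       w v = refl
  shift-indicator (suc m) zero    w v = refl
  shift-indicator (suc m) (suc n) w v = shift-indicator m n w v

  -- The sign bookkeeping when the part m is added: n = m + w and |S| grows by one.
  sgn-include : ∀ m w c → sgn ((m ℕ.+ w) ℕ.+ suc c) ≈ sgn (suc m) * sgn (((m ℕ.+ w) ∸ m) ℕ.+ c)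
  sgn-include m w c rewrite ℕP.m+n∸m≡n m w =
    trans (reflexive (P.cong sgn exponent)) (pw-+ (- 1#) (suc m) (w ℕ.+ c))
    where
    exponent : (m ℕ.+ w) ℕ.+ suc c ≡ suc m ℕ.+ (w ℕ.+ c)
    exponent = P.trans (ℕP.+-suc (m ℕ.+ w) c) (P.cong suc (ℕP.+-assoc m w c))

  φ-include : ∀ m μ n S → φ (m ∷ μ) n (true V.∷ S) ≈ sgn (suc m) * shift m n (λ k → φ μ k S)
  φ-include m μ n S =
    trans (split ((m ℕ.+ weight μ S) ℕP.≟ n))
          (sym (*-congˡ (shift-indicator m n (weight μ S) (λ k → sgn (k ℕ.+ ∣ S ∣)))))
    where
    split : (d : Dec (m ℕ.+ weight μ S ≡ n)) →
            (if does d then sgn (n ℕ.+ suc ∣ S ∣) else 0#) ≈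
            sgn (suc m) * (if does d then sgn ((n ∸ m) ℕ.+ ∣ S ∣) else 0#)
    split (yes P.refl) = sgn-include m (weight μ S) ∣ S ∣
    split (no _)       = sym (zeroʳ _)

  -- The recursion of g over the parts: S either omits the new part m or contains it.
  subsetSum-cons : ∀ m μ n → subsetSum (m ∷ μ) n ≈ subsetSum μ n + sgn (suc m) * shift m n (subsetSum μ)
  subsetSum-cons m μ n = begin
    ∑ (map (φ (m ∷ μ) n) (map (true V.∷_) Ss ++ map (false V.∷_) Ss))
      ≡⟨ P.cong ∑ (LP.map-++ (φ (m ∷ μ) n) (map (true V.∷_) Ss) _) ⟩
    ∑ (map (φ (m ∷ μ) n) (map (true V.∷_) Ss) ++ map (φ (m ∷ μ) n) (map (false V.∷_) Ss))
      ≈⟨ ∑-++ (map (φ (m ∷ μ) n) (map (true V.∷_) Ss)) _ ⟩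
    ∑ (map (φ (m ∷ μ) n) (map (true V.∷_) Ss)) + ∑ (map (φ (m ∷ μ) n) (map (false V.∷_) Ss))
      ≡⟨ P.cong₂ (λ l r → ∑ l + ∑ r) (P.sym (LP.map-∘ Ss)) (P.sym (LP.map-∘ Ss)) ⟩
    ∑ (map (λ S → φ (m ∷ μ) n (true V.∷ S)) Ss) + subsetSum μ n
      ≈⟨ +-comm _ _ ⟩
    subsetSum μ n + ∑ (map (λ S → φ (m ∷ μ) n (true V.∷ S)) Ss)
      ≈⟨ +-congˡ (∑-cong Ss (φ-include m μ n)) ⟩
    subsetSum μ n + ∑ (map (λ S → s * shift m n (λ k → φ μ k S)) Ss)
      ≈⟨ +-congˡ (sym (∑-*ˡ s _ Ss)) ⟩
    subsetSum μ n + s * ∑ (map (λ S → shift m n (λ k → φ μ k S)) Ss)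
      ≈⟨ +-congˡ (*-congˡ (sym (shift-∑ m n (φ μ) Ss))) ⟩
    subsetSum μ n + s * shift m n (subsetSum μ) ∎
    where
    s : Carrier
    s = sgn (suc m)
    Ss : List (Subset (length μ))
    Ss = allSubsets (length μ)

  -- e_n[Ξ_μ] = g_μ(n): both sides obey the same recursion over the parts of μ.
  e-Ξ : IsIntegralDomain R → (ω : ℕ → Carrier) → (∀ m → m ≥ 1 → IsPrimitiveRoot R m (ω m)) →
        ∀ μ → All (λ p → p ≥ 1) μ → ∀ n → E n (Ξ R ω μ) ≈ subsetSum μ n
  e-Ξ domain ω isPrimitive []           []                  zero    = sym (+-identityʳ _)
  e-Ξ domain ω isPrimitive []           []                  (suc n) = sym (+-identityʳ _)
  e-Ξ domain ω isPrimitive (suc m′ ∷ μ) (s≤s z≤n ∷ positive) n = begin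
    E n (map (pw (ω m)) (applyUpTo (λ i → i) m) ++ Ξ R ω μ)
      ≡⟨ P.cong (λ z → E n (z ++ Ξ R ω μ)) (LP.map-upTo (pw (ω m)) m) ⟩
    E n (Roots.X ++ Ξ R ω μ)
      ≈⟨ Roots.e-roots-++ n (Ξ R ω μ) ⟩
    E n (Ξ R ω μ) + sgn (suc m) * shift m n (λ b → E b (Ξ R ω μ))
      ≈⟨ +-cong (IH n) (*-congˡ (shift-cong m n IH)) ⟩
    subsetSum μ n + sgn (suc m) * shift m n (subsetSum μ)
      ≈⟨ sym (subsetSum-cons m μ n) ⟩
    subsetSum (m ∷ μ) n ∎
    where
    m : ℕ
    m = suc m′
    IH : ∀ k → E k (Ξ R ω μ) ≈ subsetSum μ k
    IH = e-Ξ domain ω isPrimitive μ positive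
    module Roots = RootsOfUnity domain (ω m) m′ (isPrimitive m (s≤s z≤n))

  -- Part (2).  The contribution of a sequence Ss to the signed sum over C̄_{λ,μ}, and the
  -- signed sum over all sequences.
  ψ : (μ λs : List ℕ) → Vec (Subset (length μ)) (length λs) → Carrier
  ψ μ λs Ss = if does (≡-dec ℕP._≟_ (weights μ Ss) (V.fromList λs)) then sgn (sum λs ℕ.+ totalCard Ss) else 0#

  sequenceSum : List ℕ → List ℕ → Carrier
  sequenceSum μ λs = ∑ (map (ψ μ λs) (allSeqs (length μ) (length λs)))

  if-∧ : ∀ (b₁ b₂ : Bool) x y z → x ≈ y * z →
         (if b₁ ∧ b₂ then x else 0#) ≈ (if b₁ then y else 0#) * (if b₂ then z else 0#)
  if-∧ true  true  x y z x≈yz = x≈yz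
  if-∧ true  false x y z x≈yz = sym (zeroʳ _)
  if-∧ false b₂    x y z x≈yz = sym (zeroˡ _)

  ψ-cons : ∀ μ l λs S Ss → ψ μ (l ∷ λs) (S V.∷ Ss) ≈ φ μ l S * ψ μ λs Ss
  ψ-cons μ l λs S Ss = if-∧ _ _ _ _ _ (begin
    sgn ((l ℕ.+ sum λs) ℕ.+ (∣ S ∣ ℕ.+ totalCard Ss)) ≡⟨ P.cong sgn (ℕ-interchange l (sum λs) ∣ S ∣ (totalCard Ss)) ⟩
    sgn ((l ℕ.+ ∣ S ∣) ℕ.+ (sum λs ℕ.+ totalCard Ss)) ≈⟨ pw-+ (- 1#) (l ℕ.+ ∣ S ∣) _ ⟩
    sgn (l ℕ.+ ∣ S ∣) * sgn (sum λs ℕ.+ totalCard Ss) ∎)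

  sequenceSum-cons : ∀ μ l λs → sequenceSum μ (l ∷ λs) ≈ subsetSum μ l * sequenceSum μ λs
  sequenceSum-cons μ l λs = begin
    sequenceSum μ (l ∷ λs)
      ≈⟨ ∑-cartesian (ψ μ (l ∷ λs)) Ss Bs ⟩
    ∑ (map (λ S → ∑ (map (λ Ts → ψ μ (l ∷ λs) (S V.∷ Ts)) Bs)) Ss)
      ≈⟨ ∑-cong Ss (λ S → ∑-cong Bs (ψ-cons μ l λs S)) ⟩
    ∑ (map (λ S → ∑ (map (λ Ts → φ μ l S * ψ μ λs Ts) Bs)) Ss)
      ≈⟨ ∑-cong Ss (λ S → sym (∑-*ˡ (φ μ l S) (ψ μ λs) Bs)) ⟩
    ∑ (map (λ S → φ μ l S * sequenceSum μ λs) Ss)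
      ≈⟨ sym (∑-*ʳ (sequenceSum μ λs) (φ μ l) Ss) ⟩
    subsetSum μ l * sequenceSum μ λs ∎
    where
    Ss : List (Subset (length μ))
    Ss = allSubsets (length μ)
    Bs : List (Vec (Subset (length μ)) (length λs))
    Bs = allSeqs (length μ) (length λs)

  eP-sequenceSum : ∀ xs μ → (∀ n → E n xs ≈ subsetSum μ n) → ∀ λs → eP R λs xs ≈ sequenceSum μ λs
  eP-sequenceSum xs μ e≈g []       = sym (+-identityʳ 1#)
  eP-sequenceSum xs μ e≈g (l ∷ λs) =
    trans (*-cong (e≈g l) (eP-sequenceSum xs μ e≈g λs)) (sym (sequenceSum-cons μ l λs))

  Cbar-sequenceSum : ∀ μ λs → ∑ (map (λ Ss → sgn (sum λs ℕ.+ totalCard Ss)) (Cbar λs μ)) ≈ sequenceSum μ λs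
  Cbar-sequenceSum μ λs =
    ∑-filter (λ Ss → ≡-dec ℕP._≟_ (weights μ Ss) (V.fromList λs))
             (λ Ss → sgn (sum λs ℕ.+ totalCard Ss)) (allSeqs (length μ) (length λs))

open import Data.Nat using (_+_)

mainTheorem13 : ∀ {c ℓ : Level} (R : CommutativeRing c ℓ) → IsIntegralDomain R →
                (ω : ℕ → CommutativeRing.Carrier R) → (∀ m → m ≥ 1 → IsPrimitiveRoot R m (ω m)) →
                (λs μ : List ℕ) → IsPartition λs → IsPartition μ →
                CommutativeRing._≈_ R
                  (eP R λs (Ξ R ω μ))
                  (sumR R (map (λ Ss → sign R (sum λs + totalCard Ss)) (Cbar λs μ)))
mainTheorem13 R domain ω isPrimitive λs μ _ (positive , _) = begin
  eP R λs (Ξ R ω μ)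
    ≈⟨ eP-sequenceSum R (Ξ R ω μ) μ (e-Ξ R domain ω isPrimitive μ positive) λs ⟩
  sequenceSum R μ λs
    ≈⟨ sym (Cbar-sequenceSum R μ λs) ⟩
  sumR R (map (λ Ss → sign R (sum λs + totalCard Ss)) (Cbar λs μ)) ∎
  where
  open CommutativeRing R using (sym; setoid)
  open import Relation.Binary.Reasoning.Setoid setoid
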